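{- Let $G=(V,E)$ be a multigraph, $e\in E$, $k\ge\Delta(G)+1$, $T$ a tree sequence with respect to $G$ and $e$, $C\subseteq[k]$, and $\varphi$ a $k$-edge-coloring of $G-e$. Suppose $V(T)$ is closed with respect to $\varphi$, and let $f$ be an edge with ends $u\notin V(T)$ and $v\in V(T)$. If $f$ is $T\vee C$-nonextendable with respect to $\varphi$, then for every $\alpha\in\overline{\varphi}(v)$ there exists a $(T,C\cup\{\varphi(f)\},\varphi)$-stable coloring $\pi$ such that $v$ is a $(T,\pi,\{\alpha,\varphi(f)\})$-exit.
   Context: Multigraphs are finite, loopless, parallel edges allowed; $\Delta(G)$ is the maximum degree; $[k]=\{1,\dots,k\}$. A $k$-edge-coloring of $G-e$ is a map from $E-\{e\}$ to $[k]$ giving adjacent edges distinct colors; for such $\pi$, $\overline{\pi}(v)$ is the set of colors of $[k]$ missing at $v$ and $\overline{\pi}(X)=\bigcup_{v\in X}\overline{\pi}(v)$. $\partial(X)$ is the set of edges with exactly one end in $X$. A set $X$ is closed with respect to $\pi$ if no edge of $\partial(X)-\{e\}$ has a color in $\overline{\pi}(X)$. A tree sequence with respect to $G$ and $e$ is a sequence $T=(y_0,e_1,y_1,\dots,e_p,y_p)$, $p\ge1$, of distinct vertices and distinct edges with $e_1=e$ and each $e_j$ joining $y_j$ to some $y_i$, $i<j$; $V(T)=\{y_0,\dots,y_p\}$. A $k$-edge-coloring $\pi$ of $G-e$ is $(T,C,\varphi)$-stable if (i) $\pi(f)=\varphi(f)$ for every edge $f\ne e$ incident to $V(T)$ with $\varphi(f)\in\overline{\varphi}(V(T))\cup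 C$, and (ii) $\overline{\pi}(v)=\overline{\varphi}(v)$ for all $v\in V(T)$. For colors $\alpha,\beta$, a path $P$ with at least two vertices whose edges are colored alternately $\alpha,\beta$ by $\pi$, with ends $w$ and $v\in V(T)$, is a $(T,\pi,\{\alpha,\beta\})$-exit path if $V(T)\cap V(P)=\{v\}$ and $\overline{\pi}(w)\cap\{\alpha,\beta\}\ne\emptyset$; then $v$ is a $(T,\pi,\{\alpha,\beta\})$-exit. An edge $f\in\partial(V(T))$ with end $v\in V(T)$ is $T\vee C$-nonextendable with respect to $\varphi$ if there exist a $(T,C\cup\{\varphi(f)\},\varphi)$-stable coloring $\pi$ and a color $\alpha\in\overline{\pi}(v)$ such that $v$ is a $(T,\pi,\{\alpha,\varphi(f)\})$-exit. -}

module Defs where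

open import Data.Nat using (ℕ; zero; suc; _⊔_; _≤_; _+_)
open import Data.Fin using (Fin; inject₁; _≟_) renaming (_<_ to _<ᶠ_; zero to fzero; suc to fsuc)
open import Data.Fin.Subset using (Subset; _∈_; _∪_; ⁅_⁆)
open import Data.List using (List; length; filter; foldr; map; allFin)
open import Data.Product using (Σ; ∃; ∃-syntax; _×_; _,_; proj₁; proj₂)
open import Data.Sum using (_⊎_; inj₁; inj₂)
open import Function using (Injective)
open import Relation.Nullary using (¬_; Dec)
open import Relation.Nullary.Decidable using (_⊎-dec_)
open import Relation.Binary.PropositionalEquality using (_≡_; _≢_)

-- Finite loopless multigraphs: vertices Fin n, edges Fin m (parallel
-- edges allowed since distinct edge names may have the same ends).

record Multigraph : Set where
  field
    n        : ℕ
    m        : ℕ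
    ends     : Fin m → Fin n × Fin n
    loopless : ∀ g → proj₁ (ends g) ≢ proj₂ (ends g)

module _ (G : Multigraph) where
  open Multigraph G

  Vtx : Set
  Vtx = Fin n

  Edge : Set
  Edge = Fin m

  Incident : Edge → Vtx → Set
  Incident g v = proj₁ (ends g) ≡ v ⊎ proj₂ (ends g) ≡ v

  incident? : ∀ g v → Dec (Incident g v)
  incident? g v = (proj₁ (ends g) ≟ v) ⊎-dec (proj₂ (ends g) ≟ v)

  Joins : Edge → Vtx → Vtx → Set
  Joins g a b = ends g ≡ (a , b) ⊎ ends g ≡ (b , a)

  deg : Vtx → ℕ
  deg v = length (filter (λ g → incident? g v) (allFin m))

  Δ : ℕ
  Δ = foldr _⊔_ 0 (map deg (allFin n))

  InBoundary : (Vtx → Set) → Edge → Set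
  InBoundary X g = (X (proj₁ (ends g)) × ¬ X (proj₂ (ends g)))
                 ⊎ (¬ X (proj₁ (ends g)) × X (proj₂ (ends g)))

  -- k-edge-colorings of G - e.  A coloring is a function Edge → Fin k
  -- (Fin k plays the role of [k]); its value on e is irrelevant and
  -- is never used by any of the notions below.

  module _ (e : Edge) (k : ℕ) where

    Coloring : Set
    Coloring = Edge → Fin k

    Proper : Coloring → Set
    Proper π = ∀ g h → g ≢ e → h ≢ e → g ≢ h →
               (∃[ v ] (Incident g v × Incident h v)) → π g ≢ π h

    Missing : Coloring → Vtx → Fin k → Set
    Missing π v c = ∀ g → g ≢ e → Incident g v → π g ≢ c

    MissingSet : Coloring → (Vtx → Set) → Fin k → Set
    MissingSet π X c = ∃[ v ] (X v × Missing π v c)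

    Closed : Coloring → (Vtx → Set) → Set
    Closed π X = ∀ g → InBoundary X g → g ≢ e → ¬ MissingSet π X (π g)

    -- Tree sequences T = (y₀, e₁, y₁, …, e_p, y_p), p = suc q ≥ 1.
    -- Vertex y_i is y i (i : Fin (p+1)); edge e_{j+1} is es j (j : Fin p).
    record TreeSeq : Set where
      field
        q      : ℕ
        y      : Fin (suc (suc q)) → Vtx
        es     : Fin (suc q) → Edge
        y-inj  : Injective _≡_ _≡_ y
        es-inj : Injective _≡_ _≡_ es
        first  : es fzero ≡ e
        tree   : ∀ j → ∃[ i ] (i <ᶠ fsuc j × Joins (es j) (y (fsuc j)) (y i))

    InT : TreeSeq → Vtx → Set
    InT T v = ∃[ i ] (TreeSeq.y T i ≡ v)

    Stable : TreeSeq → Subset k → Coloring → Coloring → Set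
    Stable T C φ π =
        Proper π
      × (∀ g → g ≢ e → (∃[ w ] (InT T w × Incident g w)) →
           (MissingSet φ (InT T) (φ g) ⊎ φ g ∈ C) → π g ≡ φ g)
      × (∀ v → InT T v → ∀ c → (Missing π v c → Missing φ v c)
                               × (Missing φ v c → Missing π v c))

    record ExitPath (T : TreeSeq) (π : Coloring) (α β : Fin k) (v : Vtx) : Set where
      field
        r       : ℕ
        ws      : Fin (suc (suc r)) → Vtx
        gs      : Fin (suc r) → Edge
        ws-inj  : Injective _≡_ _≡_ ws
        joins   : ∀ i → Joins (gs i) (ws (inject₁ i)) (ws (fsuc i))
        not-e   : ∀ i → gs i ≢ e
        colors  : ∀ i → π (gs i) ≡ α ⊎ π (gs i) ≡ β
        alt     : ∀ (i : Fin r) → π (gs (inject₁ i)) ≢ π (gs (fsuc i))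
        start   : ws fzero ≡ v
        inT     : InT T v
        only-v  : ∀ i → InT T (ws i) → i ≡ fzero
        end-miss : Missing π (ws (Data.Fin.fromℕ (suc r))) α
                 ⊎ Missing π (ws (Data.Fin.fromℕ (suc r))) β

    IsExit : TreeSeq → Coloring → Fin k → Fin k → Vtx → Set
    IsExit T π α β v = ExitPath T π α β v

    Nonextendable : TreeSeq → Subset k → Coloring → Edge → Vtx → Set
    Nonextendable T C φ f v =
        InBoundary (InT T) f × Incident f v × InT T v
      × ∃[ π ] (Stable T (C ∪ ⁅ φ f ⁆) φ π
               × ∃[ α ] (Missing π v α × IsExit T π α (φ f) v))

module Submission where

-- Nonextendability supplies a stable coloring π, a color α' ∈ π̄(v) and an
-- {α', φ(f)}-exit path at v.  Swap α and α' on every edge with no end in V(T).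
-- Both colors are missing at v under φ, so by closedness and stability no edge of
-- ∂(V(T)) carries α or α' under π; hence at a vertex outside V(T) all incident
-- edges are swapped, properness survives, and near V(T) nothing changes, so the
-- new coloring is stable.  Every path edge has an end outside V(T), so the path
-- becomes an {α, φ(f)}-exit path, as φ(f) ∉ {α, α'} (f ≠ e is incident to v).

open import Defs
open import Data.Nat using (ℕ; _≤_; _+_)
open import Data.Fin.Subset using (Subset; _∪_; ⁅_⁆)
open import Data.Product using (Σ; ∃; ∃-syntax; _×_; _,_; proj₁; proj₂)
open import Relation.Nullary using (¬_)

open import Data.Empty using (⊥-elim)
open import Data.Nat using (suc)
open import Data.Fin using (Fin; _≟_; inject₁; fromℕ) renaming (zero to fzero; suc to fsuc)
open import Data.Fin.Permutation.Components using (transpose; transpose-inverse)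
open import Data.Fin.Properties using (any?)
open import Data.Sum using (_⊎_; inj₁; inj₂; [_,_]) renaming (map to ⊎-map)
open import Function using (id; Injective)
open import Relation.Nullary using (Dec; yes; no)
open import Relation.Binary.PropositionalEquality
  using (_≡_; _≢_; refl; sym; trans; cong; subst; subst₂)

transpose-matchʳ : ∀ {n} (i j : Fin n) → transpose i j j ≡ i
transpose-matchʳ i j with j ≟ i
... | yes j≡i = j≡i
... | no _ with j ≟ j
...   | yes _ = refl
...   | no j≢j = ⊥-elim (j≢j refl)

transpose-mismatch : ∀ {n} {i j c : Fin n} → c ≢ i → c ≢ j → transpose i j c ≡ c
transpose-mismatch {i = i} {j} {c} c≢i c≢j with c ≟ i
... | yes c≡i = ⊥-elim (c≢i c≡i)
... | no _ with c ≟ j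
...   | yes c≡j = ⊥-elim (c≢j c≡j)
...   | no _ = refl

transpose-injective : ∀ {n} (i j : Fin n) → Injective _≡_ _≡_ (transpose i j)
transpose-injective i j eq =
  trans (sym (transpose-inverse j i)) (trans (cong (transpose j i) eq) (transpose-inverse j i))

module _ (G : Multigraph) where

  Joins⇒Incidentˡ : ∀ {g a b} → Joins G g a b → Incident G g a
  Joins⇒Incidentˡ (inj₁ p) = inj₁ (cong proj₁ p)
  Joins⇒Incidentˡ (inj₂ p) = inj₂ (cong proj₂ p)

  Joins⇒Incidentʳ : ∀ {g a b} → Joins G g a b → Incident G g b
  Joins⇒Incidentʳ (inj₁ p) = inj₂ (cong proj₂ p)
  Joins⇒Incidentʳ (inj₂ p) = inj₁ (cong proj₁ p)

  Incident-Joins : ∀ {g a b x} → Joins G g a b → Incident G g x → x ≡ a ⊎ x ≡ b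
  Incident-Joins (inj₁ p) (inj₁ q) = inj₁ (trans (sym q) (cong proj₁ p))
  Incident-Joins (inj₁ p) (inj₂ q) = inj₂ (trans (sym q) (cong proj₂ p))
  Incident-Joins (inj₂ p) (inj₁ q) = inj₂ (trans (sym q) (cong proj₁ p))
  Incident-Joins (inj₂ p) (inj₂ q) = inj₁ (trans (sym q) (cong proj₂ p))

  module _ (X : Vtx G → Set) where

    Touches : Edge G → Set
    Touches g = ∃[ w ] (X w × Incident G g w)

    boundary⇒touches : ∀ {g} → InBoundary G X g → Touches g
    boundary⇒touches (inj₁ (a , _)) = _ , a , inj₁ refl
    boundary⇒touches (inj₂ (_ , b)) = _ , b , inj₂ refl

    touches-outside⇒boundary : ∀ {g x} → Touches g → Incident G g x → ¬ X x →
                               InBoundary G X g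
    touches-outside⇒boundary (_ , w∈X , inj₁ refl) (inj₁ refl) x∉X = ⊥-elim (x∉X w∈X)
    touches-outside⇒boundary (_ , w∈X , inj₁ refl) (inj₂ refl) x∉X = inj₁ (w∈X , x∉X)
    touches-outside⇒boundary (_ , w∈X , inj₂ refl) (inj₁ refl) x∉X = inj₂ (x∉X , w∈X)
    touches-outside⇒boundary (_ , w∈X , inj₂ refl) (inj₂ refl) x∉X = ⊥-elim (x∉X w∈X)

    touches? : (∀ w → Dec (X w)) → ∀ g → Dec (Touches g)
    touches? X? g with X? (proj₁ (Multigraph.ends G g)) | X? (proj₂ (Multigraph.ends G g))
    ... | yes a | _     = yes (_ , a , inj₁ refl)
    ... | no _  | yes b = yes (_ , b , inj₂ refl)
    ... | no a  | no b  = no λ { (_ , w∈X , inj₁ refl) → a w∈X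
                               ; (_ , w∈X , inj₂ refl) → b w∈X }

  module _ (e : Edge G) (k : ℕ) where

    InT? : (T : TreeSeq G e k) → ∀ w → Dec (InT G e k T w)
    InT? T w = any? (λ i → TreeSeq.y T i ≟ w)

    first-edge-inside : (T : TreeSeq G e k) → ∀ {a} → Incident G e a → InT G e k T a
    first-edge-inside T e∋a with TreeSeq.tree T fzero
    ... | i , _ , e₁-joins =
      [ (λ a≡y₁ → fsuc fzero , sym a≡y₁) , (λ a≡yᵢ → i , sym a≡yᵢ) ]
        (Incident-Joins (subst (λ g → Joins G g _ _) (TreeSeq.first T) e₁-joins) e∋a)

    missing-map : (σ : Fin k → Fin k) → Injective _≡_ _≡_ σ → ∀ {π π' x c} →
                  (∀ {g} → g ≢ e → Incident G g x → π' g ≡ σ (π g)) →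
                  Missing G e k π x c → Missing G e k π' x (σ c)
    missing-map σ σ-inj agree c-missing g g≢e g∋x π'g≡σc =
      c-missing g g≢e g∋x (σ-inj (trans (sym (agree g≢e g∋x)) π'g≡σc))

    stable-cong : ∀ {T C φ π π'} → Stable G e k T C φ π → Proper G e k π' →
                  (∀ {g} → Touches (InT G e k T) g → π' g ≡ π g) → Stable G e k T C φ π'
    stable-cong (_ , fixed , same-missing) π'-proper agree =
        π'-proper
      , (λ g g≢e g-touches c → trans (agree g-touches) (fixed g g≢e g-touches c))
      , λ x x∈T c →
          (λ m → proj₁ (same-missing x x∈T c)
                   (missing-map id (λ p → p) (λ _ g∋x → sym (agree (x , x∈T , g∋x))) m))
        , (λ m → missing-map id (λ p → p) (λ _ g∋x → agree (x , x∈T , g∋x))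
                   (proj₂ (same-missing x x∈T c) m))

    stable-boundary-avoids : ∀ {T C φ π} → Stable G e k T C φ π →
      Closed G e k φ (InT G e k T) → ∀ {c g} → MissingSet G e k φ (InT G e k T) c →
      g ≢ e → InBoundary G (InT G e k T) g → π g ≢ c
    stable-boundary-avoids {T} {φ = φ} (π-proper , fixed , same-missing) closed {c} {g}
                           c-missing g≢e ∂g πg≡c
      with boundary⇒touches (InT G e k T) ∂g
    ... | t , t∈T , g∋t = proj₂ (same-missing t t∈T c) c-missing-at-t g g≢e g∋t πg≡c
      where
      φ-missing : ∀ {h} → φ h ≡ c → MissingSet G e k φ (InT G e k T) (φ h)
      φ-missing φh≡c = subst (MissingSet G e k φ (InT G e k T)) (sym φh≡c) c-missing

      -- a φ-edge at t colored c is either g (excluded by closedness) or, by stability,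
      -- has the same π-color as g
      c-missing-at-t : Missing G e k φ t c
      c-missing-at-t h h≢e h∋t φh≡c with h ≟ g
      ... | yes refl = closed g ∂g g≢e (φ-missing φh≡c)
      ... | no h≢g = π-proper h g h≢e g≢e h≢g (t , h∋t , g∋t)
        (trans (fixed h h≢e (t , t∈T , h∋t) (inj₁ (φ-missing φh≡c))) (trans φh≡c (sym πg≡c)))

    exitPath-map : ∀ {T π π' α β v} (σ : Fin k → Fin k) → Injective _≡_ _≡_ σ →
      (∀ {g x} → g ≢ e → Incident G g x → ¬ InT G e k T x → π' g ≡ σ (π g)) →
      ExitPath G e k T π α β v → ExitPath G e k T π' (σ α) (σ β) v
    exitPath-map {T} {π} {π'} σ σ-inj agree P = record
      { r = r ; ws = ws ; gs = gs ; ws-inj = ws-inj ; joins = joins ; not-e = not-e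
      ; colors = λ i → ⊎-map (recolored i) (recolored i) (colors i)
      ; alt = λ i eq →
          alt i (σ-inj (trans (sym (on-path (inject₁ i))) (trans eq (on-path (fsuc i)))))
      ; start = start ; inT = inT ; only-v = only-v
      ; end-miss = ⊎-map at-end at-end end-miss
      }
      where
      open ExitPath P

      inner-outside : ∀ i → ¬ InT G e k T (ws (fsuc i))
      inner-outside i w∈T with only-v (fsuc i) w∈T
      ... | ()

      on-path : ∀ i → π' (gs i) ≡ σ (π (gs i))
      on-path i = agree (not-e i) (Joins⇒Incidentʳ (joins i)) (inner-outside i)

      recolored : ∀ {c} i → π (gs i) ≡ c → π' (gs i) ≡ σ c
      recolored i refl = on-path i

      at-end : ∀ {c} → Missing G e k π (ws (fromℕ (suc r))) c →
               Missing G e k π' (ws (fromℕ (suc r))) (σ c)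
      at-end = missing-map σ σ-inj (λ g≢e g∋w → agree g≢e g∋w (inner-outside (fromℕ r)))

    module Recoloring (X : Vtx G → Set) (X? : ∀ w → Dec (X w))
                      (σ : Fin k → Fin k) (π : Coloring G e k)
                      (σ-fixes-boundary : ∀ g → g ≢ e → InBoundary G X g → σ (π g) ≡ π g) where

      recolor : Coloring G e k
      recolor g with touches? X X? g
      ... | yes _ = π g
      ... | no _  = σ (π g)

      recolor-touching : ∀ {g} → Touches X g → recolor g ≡ π g
      recolor-touching {g} g-touches with touches? X X? g
      ... | yes _ = refl
      ... | no ¬touches = ⊥-elim (¬touches g-touches)

      recolor-outside : ∀ {g x} → g ≢ e → Incident G g x → ¬ X x → recolor g ≡ σ (π g)
      recolor-outside {g} g≢e g∋x x∉X with touches? X X? g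
      ... | yes g-touches =
        sym (σ-fixes-boundary g g≢e (touches-outside⇒boundary X g-touches g∋x x∉X))
      ... | no _ = refl

      recolor-proper : Injective _≡_ _≡_ σ → Proper G e k π → Proper G e k recolor
      recolor-proper σ-inj π-proper g h g≢e h≢e g≢h (x , g∋x , h∋x) eq with X? x
      ... | yes x∈X = π-proper g h g≢e h≢e g≢h (x , g∋x , h∋x)
        (trans (sym (recolor-touching (x , x∈X , g∋x)))
               (trans eq (recolor-touching (x , x∈X , h∋x))))
      ... | no x∉X = π-proper g h g≢e h≢e g≢h (x , g∋x , h∋x)
        (σ-inj (trans (sym (recolor-outside g≢e g∋x x∉X))
                      (trans eq (recolor-outside h≢e h∋x x∉X))))

lemma2p7 : (G : Multigraph) (e : Edge G) (k : ℕ) → Δ G + 1 ≤ k →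
    (T : TreeSeq G e k) (C : Subset k) (φ : Coloring G e k) →
    Proper G e k φ →
    Closed G e k φ (InT G e k T) →
    (f : Edge G) (u v : Vtx G) → Joins G f u v →
    ¬ InT G e k T u → InT G e k T v →
    Nonextendable G e k T C φ f v →
    ∀ α → Missing G e k φ v α →
    ∃[ π ] (Stable G e k T (C ∪ ⁅ φ f ⁆) φ π × IsExit G e k T π α (φ f) v)
lemma2p7 G e k _ T C φ _ closed f u v f-joins u∉T v∈T
         (_ , _ , _ , π , π-stable , α' , α'∈π̄v , exit) α α∈φ̄v =
    recolor
  , stable-cong G e k {T} {C ∪ ⁅ φ f ⁆} {φ} {π} π-stable
      (recolor-proper σ-inj (proj₁ π-stable)) recolor-touching
  , subst₂ (λ a b → ExitPath G e k T recolor a b v) (transpose-matchʳ α α') σ-fixes-φf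
      (exitPath-map G e k σ σ-inj recolor-outside exit)
  where
  σ : Fin k → Fin k
  σ = transpose α α'

  σ-inj : Injective _≡_ _≡_ σ
  σ-inj = transpose-injective α α'

  α'∈φ̄v : Missing G e k φ v α'
  α'∈φ̄v = proj₁ (proj₂ (proj₂ π-stable) v v∈T α') α'∈π̄v

  f≢e : f ≢ e
  f≢e f≡e = u∉T (first-edge-inside G e k T
                   (subst (λ g → Incident G g u) f≡e (Joins⇒Incidentˡ G f-joins)))

  σ-fixes-φf : σ (φ f) ≡ φ f
  σ-fixes-φf = transpose-mismatch (α∈φ̄v f f≢e f∋v) (α'∈φ̄v f f≢e f∋v)
    where
    f∋v : Incident G f v
    f∋v = Joins⇒Incidentʳ G f-joins

  π-boundary-avoids : ∀ {c g} → Missing G e k φ v c → g ≢ e →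
                      InBoundary G (InT G e k T) g → π g ≢ c
  π-boundary-avoids c∈φ̄v = stable-boundary-avoids G e k {T} {C ∪ ⁅ φ f ⁆} {φ} {π}
                              π-stable closed (v , v∈T , c∈φ̄v)

  σ-fixes-boundary : ∀ g → g ≢ e → InBoundary G (InT G e k T) g → σ (π g) ≡ π g
  σ-fixes-boundary g g≢e ∂g =
    transpose-mismatch (π-boundary-avoids α∈φ̄v g≢e ∂g) (π-boundary-avoids α'∈φ̄v g≢e ∂g)

  open Recoloring G e k (InT G e k T) (InT? G e k T) σ π σ-fixes-boundary
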